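{- Let $G=(V,E)$ be a graph and $q\in\mathbb{N}$ with $q\geq 1$. Then $G$ is 3-colorable if and only if the $q$-complete graph $C_q(G)$ is 3-colorable.
   Context: For a graph $G=(V,E)$ and positive integer $q$, the $q$-complete graph $C_q(G)=(V_q,E_q)$ has vertex set $V_q=V^1\uplus\dots\uplus V^q$ where $V^i=\{v^i\mid v\in V\}$ is a copy of $V$ for each $i\in\{1,\dots,q\}$, and edge set $E_q=\bigcup_{i,j\in\{1,\dots,q\}}\{\{u^i,v^j\}\mid \{u,v\}\in E\}$. A graph is 3-colorable if there is a map $f$ from its vertices to $\{1,2,3\}$ with $f(v)\neq f(w)$ for every edge $\{v,w\}$. -}

module Defs where

open import Data.Nat using (ℕ)
open import Data.Fin using (Fin)
open import Data.Product using (_×_; _,_; Σ)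
open import Relation.Binary.PropositionalEquality using (_≢_)
open import Relation.Nullary using (¬_)
open import Level using (0ℓ; suc)

record Graph : Set₁ where
  field
    n     : ℕ
    Adj   : Fin n → Fin n → Set
    sym   : ∀ {u v} → Adj u v → Adj v u
    irref : ∀ {v} → ¬ Adj v v

ThreeColorableRel : {W : Set} → (W → W → Set) → Set
ThreeColorableRel {W} Adj =
  Σ (W → Fin 3) (λ f → ∀ v w → Adj v w → f v ≢ f w)

ThreeColorable : Graph → Set
ThreeColorable G = ThreeColorableRel (Graph.Adj G)

-- The q-complete graph C_q(G): vertices v^i = (i , v) for i ∈ {1..q}
-- (indexed by Fin q), and {u^i , v^j} is an edge iff {u , v} ∈ E.
CqAdj : (q : ℕ) (G : Graph) → (Fin q × Fin (Graph.n G)) → (Fin q × Fin (Graph.n G)) → Set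
CqAdj q G (i , u) (j , v) = Graph.Adj G u v

ThreeColorableCq : (q : ℕ) → Graph → Set
ThreeColorableCq q G = ThreeColorableRel (CqAdj q G)

module Submission where

open import Defs
open import Data.Nat using (ℕ; _≥_; s≤s)
open import Data.Fin using (Fin; zero)
open import Data.Product using (_,_; proj₂)
open import Function.Bundles using (_⇔_; mk⇔)

-- C_q(G) and G are homomorphically equivalent: the projection (i , v) ↦ v maps
-- C_q(G) onto G, and any single copy v ↦ (i , v) embeds G into C_q(G)
-- (a copy exists because q ≥ 1).
-- 3-colorability is closed under pulling back along homomorphisms.

IsHomomorphism : {V W : Set} → (V → V → Set) → (W → W → Set) → (V → W) → Set
IsHomomorphism {V} AdjV AdjW h = ∀ u v → AdjV u v → AdjW (h u) (h v)

threeColorable-pullback : {V W : Set} {AdjV : V → V → Set} {AdjW : W → W → Set}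
  (h : V → W) → IsHomomorphism AdjV AdjW h →
  ThreeColorableRel AdjW → ThreeColorableRel AdjV
threeColorable-pullback h hom (f , proper) =
  (λ v → f (h v)) , (λ u v a → proper (h u) (h v) (hom u v a))

projection-isHomomorphism : (q : ℕ) (G : Graph) →
  IsHomomorphism (CqAdj q G) (Graph.Adj G) proj₂
projection-isHomomorphism q G (i , u) (j , v) a = a

copy-isHomomorphism : (q : ℕ) (G : Graph) (i : Fin q) →
  IsHomomorphism (Graph.Adj G) (CqAdj q G) (i ,_)
copy-isHomomorphism q G i u v a = a

mainTheorem6 : (G : Graph) (q : ℕ) → q ≥ 1 → ThreeColorable G ⇔ ThreeColorableCq q G
mainTheorem6 G (ℕ.suc q) (s≤s _) = mk⇔
  (threeColorable-pullback proj₂ (projection-isHomomorphism (ℕ.suc q) G))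
  (threeColorable-pullback (zero ,_) (copy-isHomomorphism (ℕ.suc q) G zero))
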